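{- Let $H$ be a connected graph with $\gamma_{r2}(H)=3$ such that for every $2$-rainbow dominating function $\varphi$ of $H$ of minimum weight, $\varphi(h)\ne\{1,2\}$ for every vertex $h$ of $H$. Then for any graph $G$, \[\gamma_{r2}(G\circ H)=\min\{\,2|A|+3|B| \;:\; (A,B) \text{ is a dominating couple of } G\,\}.\]
   Context: All graphs are finite and simple. A $2$-rainbow dominating function of a graph $X$ is a map $f\colon V(X)\to 2^{\{1,2\}}$ such that for every vertex $v$ with $f(v)=\emptyset$ we have $\bigcup_{u\in N(v)} f(u)=\{1,2\}$; its weight is $\sum_v |f(v)|$, and $\gamma_{r2}(X)$ is the minimum weight of such a function. The lexicographic product $G\circ H$ has vertex set $V(G)\times V(H)$, with $(g_1,h_1)$ adjacent to $(g_2,h_2)$ iff $g_1g_2\in E(G)$, or $g_1=g_2$ and $h_1h_2\in E(H)$. An ordered pair $(A,B)$ of disjoint subsets $A,B\subseteq V(G)$ is a dominating couple of $G$ if for every vertex $x\in V(G)\setminus B$ there is a vertex $w\in A\cup B$ with $x\in N_G(w)$. -}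

module Defs where

open import Data.Nat using (ℕ; _+_; _*_; _≤_)
open import Data.Fin using (Fin; remQuot)
open import Data.Fin.Properties using (_≟_)
open import Data.Fin.Subset using (Subset; _∈_; _∉_; ∣_∣; _∩_; Empty)
open import Data.Bool using (Bool; true; false; _∨_; _∧_)
open import Data.List using (map; allFin)
open import Data.Nat.ListAction using (sum)
open import Data.Product using (Σ; ∃; _×_; _,_; proj₁; proj₂)
open import Data.Sum using (_⊎_)
open import Relation.Nullary using (¬_; does; yes; no)
open import Data.Empty using (⊥-elim)
open import Relation.Binary.PropositionalEquality using (_≡_; refl)

record Graph : Set where
  field
    n      : ℕ
    adj    : Fin n → Fin n → Bool
    sym    : ∀ u v → adj u v ≡ adj v u
    irrefl : ∀ v → adj v v ≡ false

open Graph public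

V : Graph → Set
V G = Fin (n G)

Adj : (G : Graph) → V G → V G → Set
Adj G u v = adj G u v ≡ true

data Reach (G : Graph) : V G → V G → Set where
  here : ∀ {u} → Reach G u u
  step : ∀ {u v w} → Adj G u v → Reach G v w → Reach G u w

Connected : Graph → Set
Connected G = ∀ u v → Reach G u v

-- Lexicographic product G ∘ H on Fin (n G * n H); a vertex i is
-- identified with the pair remQuot (n H) i : Fin (n G) × Fin (n H).
private
  pairAdj : (G H : Graph) → Fin (n G) × Fin (n H) → Fin (n G) × Fin (n H) → Bool
  pairAdj G H (g₁ , h₁) (g₂ , h₂) = adj G g₁ g₂ ∨ (does (g₁ ≟ g₂) ∧ adj H h₁ h₂)

  lexAdj : (G H : Graph) → Fin (n G * n H) → Fin (n G * n H) → Bool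
  lexAdj G H i j = pairAdj G H (remQuot {n G} (n H) i) (remQuot {n G} (n H) j)

  ≟-sym : ∀ {k} (a b : Fin k) → does (a ≟ b) ≡ does (b ≟ a)
  ≟-sym a b with a ≟ b | b ≟ a
  ... | yes _ | yes _ = refl
  ... | no _ | no _ = refl
  ... | yes refl | no q = ⊥-elim (q refl)
  ... | no q | yes refl = ⊥-elim (q refl)

  pairSym : (G H : Graph) → ∀ p q → pairAdj G H p q ≡ pairAdj G H q p
  pairSym G H (g₁ , h₁) (g₂ , h₂)
    rewrite sym G g₁ g₂ | ≟-sym g₁ g₂ | sym H h₁ h₂ = refl

  pairIrr : (G H : Graph) → ∀ p → pairAdj G H p p ≡ false
  pairIrr G H (g , h) rewrite irrefl G g | irrefl H h with does (g ≟ g)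
  ... | false = refl
  ... | true = refl

  lexSym : (G H : Graph) → ∀ i j → lexAdj G H i j ≡ lexAdj G H j i
  lexSym G H i j = pairSym G H (remQuot {n G} (n H) i) (remQuot {n G} (n H) j)

  lexIrr : (G H : Graph) → ∀ i → lexAdj G H i i ≡ false
  lexIrr G H i = pairIrr G H (remQuot {n G} (n H) i)

_∘ₗ_ : Graph → Graph → Graph
G ∘ₗ H = record
  { n = n G * n H
  ; adj = lexAdj G H
  ; sym = lexSym G H
  ; irrefl = lexIrr G H
  }

-- Subsets of {1,2}.
data Label : Set where
  ∅ one two both : Label

∣_∣ₗ : Label → ℕ
∣ ∅ ∣ₗ = 0
∣ one ∣ₗ = 1
∣ two ∣ₗ = 1
∣ both ∣ₗ = 2

Has1 Has2 : Label → Set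
Has1 l = l ≡ one ⊎ l ≡ both
Has2 l = l ≡ two ⊎ l ≡ both

IsR2DF : (G : Graph) → (V G → Label) → Set
IsR2DF G f = ∀ v → f v ≡ ∅ →
  (∃ λ u → Adj G v u × Has1 (f u)) × (∃ λ u → Adj G v u × Has2 (f u))

weight : (G : Graph) → (V G → Label) → ℕ
weight G f = sum (map (λ v → ∣ f v ∣ₗ) (allFin (n G)))

γr2≡ : Graph → ℕ → Set
γr2≡ G k = (Σ (V G → Label) λ f → IsR2DF G f × weight G f ≡ k)
         × (∀ f → IsR2DF G f → k ≤ weight G f)

IsMinR2DF : (G : Graph) → (V G → Label) → Set
IsMinR2DF G f = IsR2DF G f × (∀ g → IsR2DF G g → weight G f ≤ weight G g)

IsDomCouple : (G : Graph) → Subset (n G) → Subset (n G) → Set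
IsDomCouple G A B = Empty (A ∩ B) ×
  (∀ x → x ∉ B → ∃ λ w → (w ∈ A ⊎ w ∈ B) × Adj G w x)

minCouple≡ : Graph → ℕ → Set
minCouple≡ G k =
  (Σ (Subset (n G)) λ A → Σ (Subset (n G)) λ B →
      IsDomCouple G A B × 2 * ∣ A ∣ + 3 * ∣ B ∣ ≡ k)
  × (∀ A B → IsDomCouple G A B → k ≤ 2 * ∣ A ∣ + 3 * ∣ B ∣)

-- A 2RDF f of G ∘ H gives, for each colour c, a dominating couple (A_c , B_c) of G:
-- B_c holds the g no G-neighbour of which has c in its fibre, A_c the remaining g
-- whose own fibre contains c.  The fibre φ over g ∈ B_c must c-dominate itself in
-- H.  If no vertex holds only c under φ, then φ is a 2RDF of H, of weight ≥ 3;
-- otherwise adding the missing colour wherever φ holds only c gives a 2RDF of H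
-- using {1,2}, hence not minimum, hence of weight ≥ 4, and that weight is at most
-- 2·#c(φ) + #c′(φ).  Summing over g, the costs 2|A_c| + 3|B_c| of the two couples
-- add up to at most 2 w(f).  Conversely a dominating couple (A , B) yields a 2RDF
-- of weight at most 2|A| + 3|B|: a bichromatic 2RDF of H of weight 3 on each fibre
-- over B, and a single vertex labelled {1,2} on each fibre over A.

module Submission where

open import Data.Bool using (Bool; true; false; _∧_; _∨_; if_then_else_)
import Data.Bool.Properties as Bool
open import Data.Empty using (⊥-elim)
open import Data.Fin using (Fin; zero; suc; _↑ˡ_; _↑ʳ_; combine; remQuot)
open import Data.Fin.Properties using (_≟_; any?; all?; remQuot-combine; combine-remQuot)
open import Data.Fin.Subset using (Subset; _∈_; _∉_; ∣_∣; _∩_; Empty; ⊥; ⊤)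
open import Data.Fin.Subset.Properties using (_∈?_; anySubset?; x∈p∩q⁻; ∉⊥; ∈⊤)
import Data.Fin.Properties as Fin
open import Data.List using (allFin; tabulate)
open import Data.List.Properties using (map-tabulate; map-cong)
open import Data.Nat using (ℕ; zero; suc; _+_; _*_; _≤_; _<_; _≤?_; z≤n; s≤s)
open import Data.Nat.ListAction using () renaming (sum to sumˡ)
open import Data.Nat.Properties hiding (_≟_)
open import Data.Nat.Properties using () renaming (_≟_ to _≟ℕ_)
open import Data.Product using (Σ; ∃; ∃₂; _×_; _,_; proj₁; proj₂; uncurry)
open import Data.Sum using (_⊎_; inj₁; inj₂)
open import Data.Vec using (_∷_; [])
import Data.Vec as Vec
open import Data.Vec.Properties using (lookup∘tabulate; []=⇒lookup; lookup⇒[]=)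
open import Function using (_∘_; id; mk⇔; case_of_)
open import Relation.Binary.PropositionalEquality
open import Relation.Nullary using (¬_; Dec; yes; no; does; _because_)
open import Relation.Nullary.Decidable
  using (_×-dec_; _⊎-dec_; _→-dec_; ¬?; dec-true; dec-false; dec-yes; dec-no; does-⇔; decidable-stable)
open import Relation.Unary using (Decidable)
open import Algebra.Properties.CommutativeSemigroup +-commutativeSemigroup using (interchange)
open import Algebra.Properties.CommutativeMonoid.Sum +-0-commutativeMonoid
  using (sum-syntax; sum-cong-≗; sum-replicate-zero) renaming (sum to ∑)

open import Defs renaming (sym to adj-sym)

∑-distrib-+ : ∀ {m} (F G : Fin m → ℕ) → ∑[ i < m ] (F i + G i) ≡ ∑ F + ∑ G
∑-distrib-+ {zero}  F G = refl
∑-distrib-+ {suc m} F G =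
  trans (cong (F zero + G zero +_) (∑-distrib-+ (F ∘ suc) (G ∘ suc)))
        (interchange (F zero) (G zero) (∑ (F ∘ suc)) (∑ (G ∘ suc)))

*-distribˡ-∑ : ∀ {m} c (F : Fin m → ℕ) → c * ∑ F ≡ ∑[ i < m ] (c * F i)
*-distribˡ-∑ {zero}  c F = *-zeroʳ c
*-distribˡ-∑ {suc m} c F =
  trans (*-distribˡ-+ c (F zero) (∑ (F ∘ suc)))
        (cong (c * F zero +_) (*-distribˡ-∑ c (F ∘ suc)))

∑-mono-≤ : ∀ {m} {F G : Fin m → ℕ} → (∀ i → F i ≤ G i) → ∑ F ≤ ∑ G
∑-mono-≤ {zero}  _   = z≤n
∑-mono-≤ {suc m} F≤G = +-mono-≤ (F≤G zero) (∑-mono-≤ (F≤G ∘ suc))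

term≤∑ : ∀ {m} (F : Fin m → ℕ) i → F i ≤ ∑ F
term≤∑ F zero    = m≤m+n (F zero) _
term≤∑ F (suc i) = m≤n⇒m≤o+n (F zero) (term≤∑ (F ∘ suc) i)

∑-zero : ∀ {m} {F : Fin m → ℕ} → (∀ i → F i ≡ 0) → ∑ F ≡ 0
∑-zero {m} F≡0 = trans (sum-cong-≗ F≡0) (sum-replicate-zero m)

∑-single : ∀ {m} (a : Fin m) (F : Fin m → ℕ) → (∀ i → i ≢ a → F i ≡ 0) → ∑ F ≡ F a
∑-single zero    F F≡0 =
  trans (cong (F zero +_) (∑-zero (λ i → F≡0 (suc i) λ ()))) (+-identityʳ (F zero))
∑-single (suc a) F F≡0 =
  trans (cong (_+ ∑ (F ∘ suc)) (F≡0 zero λ ()))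
        (∑-single a (F ∘ suc) (λ i i≢a → F≡0 (suc i) (i≢a ∘ Fin.suc-injective)))

∑-ones : ∀ m → ∑[ i < m ] 1 ≡ m
∑-ones zero    = refl
∑-ones (suc m) = cong suc (∑-ones m)

∑-↑ : ∀ m {k} (F : Fin (m + k) → ℕ) → ∑ F ≡ ∑[ i < m ] F (i ↑ˡ k) + ∑[ j < k ] F (m ↑ʳ j)
∑-↑ zero    F = refl
∑-↑ (suc m) F = trans (cong (F zero +_) (∑-↑ m (F ∘ suc))) (sym (+-assoc (F zero) _ _))

∑-combine : ∀ m k (F : Fin (m * k) → ℕ) → ∑ F ≡ ∑[ i < m ] ∑[ j < k ] F (combine i j)
∑-combine zero    k F = refl
∑-combine (suc m) k F =
  trans (∑-↑ k F) (cong (∑[ j < k ] F (j ↑ˡ m * k) +_) (∑-combine m k (F ∘ (k ↑ʳ_))))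

sumˡ-tabulate : ∀ {m} (F : Fin m → ℕ) → sumˡ (tabulate F) ≡ ∑ F
sumˡ-tabulate {zero}  F = refl
sumˡ-tabulate {suc m} F = cong (F zero +_) (sumˡ-tabulate (F ∘ suc))

𝟙 : Bool → ℕ
𝟙 true  = 1
𝟙 false = 0

𝟙[_∈_] : ∀ {m} → Fin m → Subset m → ℕ
𝟙[ i ∈ p ] = 𝟙 (does (i ∈? p))

∣p∣≡∑ : ∀ {m} (p : Subset m) → ∣ p ∣ ≡ ∑[ i < m ] 𝟙[ i ∈ p ]
∣p∣≡∑ []          = refl
∣p∣≡∑ (true ∷ p)  = cong suc (∣p∣≡∑ p)
∣p∣≡∑ (false ∷ p) = ∣p∣≡∑ p

card-combination≡∑ : ∀ {m} a b (A B : Subset m) →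
  a * ∣ A ∣ + b * ∣ B ∣ ≡ ∑[ i < m ] (a * 𝟙[ i ∈ A ] + b * 𝟙[ i ∈ B ])
card-combination≡∑ a b A B = begin
  a * ∣ A ∣ + b * ∣ B ∣
    ≡⟨ cong₂ (λ x y → a * x + b * y) (∣p∣≡∑ A) (∣p∣≡∑ B) ⟩
  a * ∑ 𝟙[_∈ A ] + b * ∑ 𝟙[_∈ B ]
    ≡⟨ cong₂ _+_ (*-distribˡ-∑ a 𝟙[_∈ A ]) (*-distribˡ-∑ b 𝟙[_∈ B ]) ⟩
  ∑ (λ i → a * 𝟙[ i ∈ A ]) + ∑ (λ i → b * 𝟙[ i ∈ B ])
    ≡⟨ ∑-distrib-+ (λ i → a * 𝟙[ i ∈ A ]) (λ i → b * 𝟙[ i ∈ B ]) ⟨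
  ∑ (λ i → a * 𝟙[ i ∈ A ] + b * 𝟙[ i ∈ B ]) ∎
  where open ≡-Reasoning

subsetOf : ∀ {m} {P : Fin m → Set} → Decidable P → Subset m
subsetOf P? = Vec.tabulate (does ∘ P?)

module _ {m} {P : Fin m → Set} (P? : Decidable P) where

  ∈-subsetOf⁺ : ∀ {x} → P x → x ∈ subsetOf P?
  ∈-subsetOf⁺ {x} p = lookup⇒[]= x _ (trans (lookup∘tabulate _ x) (dec-true (P? x) p))

  ∈-subsetOf⁻ : ∀ {x} → x ∈ subsetOf P? → P x
  ∈-subsetOf⁻ {x} x∈ with P? x | trans (sym (lookup∘tabulate _ x)) ([]=⇒lookup x∈)
  ... | yes px | _ = px

  does-∈-subsetOf : ∀ x → does (x ∈? subsetOf P?) ≡ does (P? x)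
  does-∈-subsetOf x = does-⇔ (mk⇔ ∈-subsetOf⁻ ∈-subsetOf⁺) (x ∈? subsetOf P?) (P? x)

coupleCost : ∀ {m} → Subset m → Subset m → ℕ
coupleCost A B = 2 * ∣ A ∣ + 3 * ∣ B ∣

data Colour : Set where
  c₁ c₂ : Colour

other : Colour → Colour
other c₁ = c₂
other c₂ = c₁

Has : Colour → Label → Set
Has c₁ = Has1
Has c₂ = Has2

Has-both : ∀ c → Has c both
Has-both c₁ = inj₂ refl
Has-both c₂ = inj₂ refl

occ : Colour → Label → ℕ
occ c₁ one  = 1
occ c₂ two  = 1
occ _  both = 1
occ _  _    = 0

occ-+ : ∀ l → occ c₁ l + occ c₂ l ≡ ∣ l ∣ₗ
occ-+ ∅    = refl
occ-+ one  = refl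
occ-+ two  = refl
occ-+ both = refl

Has⇒1≤occ : ∀ c {l} → Has c l → 1 ≤ occ c l
Has⇒1≤occ c₁ (inj₁ refl) = s≤s z≤n
Has⇒1≤occ c₁ (inj₂ refl) = s≤s z≤n
Has⇒1≤occ c₂ (inj₁ refl) = s≤s z≤n
Has⇒1≤occ c₂ (inj₂ refl) = s≤s z≤n

only : Colour → Label
only c₁ = one
only c₂ = two

Has∧≢only⇒both : ∀ c {l} → Has c l → l ≢ only c → l ≡ both
Has∧≢only⇒both c₁ (inj₁ refl) ≢one = ⊥-elim (≢one refl)
Has∧≢only⇒both c₂ (inj₁ refl) ≢two = ⊥-elim (≢two refl)
Has∧≢only⇒both c₁ (inj₂ refl) _    = refl
Has∧≢only⇒both c₂ (inj₂ refl) _    = refl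

only? : ∀ c l → Dec (l ≡ only c)
only? c₁ ∅    = no λ ()
only? c₁ one  = yes refl
only? c₁ two  = no λ ()
only? c₁ both = no λ ()
only? c₂ ∅    = no λ ()
only? c₂ one  = no λ ()
only? c₂ two  = yes refl
only? c₂ both = no λ ()

∅? : ∀ l → Dec (l ≡ ∅)
∅? ∅    = yes refl
∅? one  = no λ ()
∅? two  = no λ ()
∅? both = no λ ()

≢∅⇒1≤∣∣ : ∀ {l} → l ≢ ∅ → 1 ≤ ∣ l ∣ₗ
≢∅⇒1≤∣∣ {∅}    l≢∅ = ⊥-elim (l≢∅ refl)
≢∅⇒1≤∣∣ {one}  _   = s≤s z≤n
≢∅⇒1≤∣∣ {two}  _   = s≤s z≤n
≢∅⇒1≤∣∣ {both} _   = s≤s z≤n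

saturate : Colour → Label → Label
saturate c₁ one = both
saturate c₂ two = both
saturate _  l   = l

saturate-only : ∀ c → saturate c (only c) ≡ both
saturate-only c₁ = refl
saturate-only c₂ = refl

saturate≡∅⇒≡∅ : ∀ c l → saturate c l ≡ ∅ → l ≡ ∅
saturate≡∅⇒≡∅ c₁ ∅ _ = refl
saturate≡∅⇒≡∅ c₂ ∅ _ = refl

Has⇒saturate≡both : ∀ c {l} → Has c l → saturate c l ≡ both
Has⇒saturate≡both c₁ (inj₁ refl) = refl
Has⇒saturate≡both c₂ (inj₁ refl) = refl
Has⇒saturate≡both c₁ (inj₂ refl) = refl
Has⇒saturate≡both c₂ (inj₂ refl) = refl

∣saturate∣≤ : ∀ c l → ∣ saturate c l ∣ₗ ≤ 2 * occ c l + occ (other c) l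
∣saturate∣≤ c₁ ∅    = z≤n
∣saturate∣≤ c₁ one  = ≤-refl
∣saturate∣≤ c₁ two  = ≤-refl
∣saturate∣≤ c₁ both = s≤s (s≤s z≤n)
∣saturate∣≤ c₂ ∅    = z≤n
∣saturate∣≤ c₂ one  = ≤-refl
∣saturate∣≤ c₂ two  = ≤-refl
∣saturate∣≤ c₂ both = s≤s (s≤s z≤n)

Dominates : (G : Graph) → Colour → (V G → Label) → Set
Dominates G c f = ∀ v → f v ≡ ∅ → ∃ λ u → Adj G v u × Has c (f u)

module _ {G : Graph} {f : V G → Label} where

  r2df⇒dominates : IsR2DF G f → ∀ c → Dominates G c f
  r2df⇒dominates rf c₁ v fv≡∅ = proj₁ (rf v fv≡∅)
  r2df⇒dominates rf c₂ v fv≡∅ = proj₂ (rf v fv≡∅)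

  dominates⇒r2df : (∀ c → Dominates G c f) → IsR2DF G f
  dominates⇒r2df dom v fv≡∅ = dom c₁ v fv≡∅ , dom c₂ v fv≡∅

  both-neighbour⇒r2df : (∀ v → f v ≡ ∅ → ∃ λ u → Adj G v u × f u ≡ both) → IsR2DF G f
  both-neighbour⇒r2df nb = dominates⇒r2df λ c v fv≡∅ →
    let u , vu , fu≡both = nb v fv≡∅ in u , vu , subst (Has c) (sym fu≡both) (Has-both c)

weightᶜ : (G : Graph) → Colour → (V G → Label) → ℕ
weightᶜ G c f = ∑[ v < n G ] occ c (f v)

module _ (G : Graph) where

  weight≡∑ : ∀ f → weight G f ≡ ∑[ v < n G ] ∣ f v ∣ₗ
  weight≡∑ f = trans (cong sumˡ (map-tabulate id (∣_∣ₗ ∘ f))) (sumˡ-tabulate (∣_∣ₗ ∘ f))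

  weight-cong : ∀ {f f′} → (∀ v → f v ≡ f′ v) → weight G f ≡ weight G f′
  weight-cong f≗f′ = cong sumˡ (map-cong (cong ∣_∣ₗ ∘ f≗f′) (allFin (n G)))

  weight≡weightᶜ+weightᶜ : ∀ c f → weight G f ≡ weightᶜ G c f + weightᶜ G (other c) f
  weight≡weightᶜ+weightᶜ c₁ f =
    trans (weight≡∑ f)
          (trans (sum-cong-≗ (sym ∘ occ-+ ∘ f)) (∑-distrib-+ (occ c₁ ∘ f) (occ c₂ ∘ f)))
  weight≡weightᶜ+weightᶜ c₂ f =
    trans (weight≡weightᶜ+weightᶜ c₁ f) (+-comm (weightᶜ G c₁ f) _)

  γr2≤order : ∀ {k} → γr2≡ G k → k ≤ n G
  γr2≤order (_ , k≤) =
    subst (_ ≤_) (trans (weight≡∑ (λ _ → one)) (∑-ones (n G))) (k≤ (λ _ → one) λ _ ())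

-- The lexicographic product

∃-combine : ∀ {m k} {P : Fin (m * k) → Set} → ∃ P → ∃₂ λ i j → P (combine i j)
∃-combine {m} {k} {P} (v , pv) =
  proj₁ (remQuot {m} k v) , proj₂ (remQuot {m} k v) , subst P (sym (combine-remQuot {m} k v)) pv

∀-combine : ∀ {m k} {P : Fin (m * k) → Set} → (∀ i j → P (combine i j)) → ∀ v → P v
∀-combine {m} {k} {P} p v =
  subst P (combine-remQuot {m} k v) (p (proj₁ (remQuot {m} k v)) (proj₂ (remQuot {m} k v)))

fromFibres : ∀ {m k} {A : Set} → (Fin m → Fin k → A) → Fin (m * k) → A
fromFibres {m} {k} F v = uncurry F (remQuot {m} k v)

fromFibres-combine : ∀ {m k} {A : Set} (F : Fin m → Fin k → A) i j →
  fromFibres F (combine i j) ≡ F i j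
fromFibres-combine F i j = cong (uncurry F) (remQuot-combine i j)

module _ (G H : Graph) where

  lex-adj : ∀ g h g′ h′ →
    adj (G ∘ₗ H) (combine g h) (combine g′ h′) ≡ adj G g g′ ∨ (does (g ≟ g′) ∧ adj H h h′)
  lex-adj g h g′ h′ = cong₂ pair-adj (remQuot-combine g h) (remQuot-combine g′ h′)
    where
    pair-adj : V G × V H → V G × V H → Bool
    pair-adj (g , h) (g′ , h′) = adj G g g′ ∨ (does (g ≟ g′) ∧ adj H h h′)

  lex-adj⁻ : ∀ {g h g′ h′} → Adj (G ∘ₗ H) (combine g h) (combine g′ h′) →
    Adj G g g′ ⊎ (g ≡ g′ × Adj H h h′)
  lex-adj⁻ {g} {h} {g′} {h′} e
    with adj G g g′ | g ≟ g′ | trans (sym (lex-adj g h g′ h′)) e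
  ... | true  | _         | _   = inj₁ refl
  ... | false | yes g≡g′  | hh′ = inj₂ (g≡g′ , hh′)

  lex-adj-outer : ∀ {g g′} h h′ → Adj G g g′ → Adj (G ∘ₗ H) (combine g h) (combine g′ h′)
  lex-adj-outer {g} {g′} h h′ gg′ = trans (lex-adj g h g′ h′) (cong (_∨ _) gg′)

  lex-adj-inner : ∀ g {h h′} → Adj H h h′ → Adj (G ∘ₗ H) (combine g h) (combine g h′)
  lex-adj-inner g {h} {h′} hh′ =
    trans (lex-adj g h g h′) (cong₂ _∨_ (irrefl G g) (cong₂ _∧_ (dec-true (g ≟ g) refl) hh′))

  weight-lex : ∀ f → weight (G ∘ₗ H) f ≡ ∑[ g < n G ] weight H (λ h → f (combine g h))
  weight-lex f = begin
    weight (G ∘ₗ H) f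
      ≡⟨ weight≡∑ (G ∘ₗ H) f ⟩
    ∑ (λ v → ∣ f v ∣ₗ)
      ≡⟨ ∑-combine (n G) (n H) (λ v → ∣ f v ∣ₗ) ⟩
    ∑[ g < n G ] ∑[ h < n H ] ∣ f (combine g h) ∣ₗ
      ≡⟨ sum-cong-≗ (λ (g : V G) → weight≡∑ H (λ h → f (combine g h))) ⟨
    ∑[ g < n G ] weight H (λ h → f (combine g h)) ∎
    where open ≡-Reasoning

-- The factor H

distinct-pair : ∀ {m} → 2 ≤ m → Σ (Fin m) λ a → Σ (Fin m) λ b → a ≢ b
distinct-pair (s≤s (s≤s _)) = zero , suc zero , λ ()

Bichromatic : (H : Graph) → (V H → Label) → Set
Bichromatic H φ = ∀ c → ∃ λ (h : V H) → Has c (φ h)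

-- An empty vertex already sees both colours; otherwise every label is nonempty,
-- and one `one` with `two` everywhere else is no heavier.
bichromatic-r2df : ∀ H → 2 ≤ n H → ∀ φ → IsR2DF H φ →
  ∃ λ ψ → IsR2DF H ψ × weight H ψ ≤ weight H φ × Bichromatic H ψ
bichromatic-r2df H 2≤n φ rφ with any? (λ h → ∅? (φ h))
... | yes (h , φh≡∅) =
  φ , rφ , ≤-refl , λ c → let u , _ , has = r2df⇒dominates {H} rφ c h φh≡∅ in u , has
... | no no-∅ = ψ , rψ , ψ≤φ , bichromatic
  where
  a = proj₁ (distinct-pair 2≤n)
  b = proj₁ (proj₂ (distinct-pair 2≤n))
  a≢b = proj₂ (proj₂ (distinct-pair 2≤n))

  ψ : V H → Label
  ψ h = if does (h ≟ a) then one else two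

  rψ : IsR2DF H ψ
  rψ h ψh≡∅ with does (h ≟ a)
  rψ h () | true
  rψ h () | false

  ∣ψ∣≤∣φ∣ : ∀ h → ∣ ψ h ∣ₗ ≤ ∣ φ h ∣ₗ
  ∣ψ∣≤∣φ∣ h with does (h ≟ a)
  ... | true  = ≢∅⇒1≤∣∣ λ φh≡∅ → no-∅ (h , φh≡∅)
  ... | false = ≢∅⇒1≤∣∣ λ φh≡∅ → no-∅ (h , φh≡∅)

  ψ≤φ : weight H ψ ≤ weight H φ
  ψ≤φ = subst₂ _≤_ (sym (weight≡∑ H ψ)) (sym (weight≡∑ H φ)) (∑-mono-≤ ∣ψ∣≤∣φ∣)

  bichromatic : Bichromatic H ψ
  bichromatic c₁ = a , inj₁ (cong (if_then one else two) (dec-true (a ≟ a) refl))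
  bichromatic c₂ = b , inj₁ (cong (if_then one else two) (dec-false (b ≟ a) (a≢b ∘ sym)))

bichromatic-minimum : ∀ H → γr2≡ H 3 →
  ∃ λ ψ → IsR2DF H ψ × weight H ψ ≤ 3 × Bichromatic H ψ
bichromatic-minimum H γ≡3@((φ , rφ , w≡3) , _)
  with bichromatic-r2df H (≤-trans (n≤1+n 2) (γr2≤order H γ≡3)) φ rφ
... | ψ , rψ , ψ≤φ , bi = ψ , rψ , ≤-trans ψ≤φ (≤-reflexive w≡3) , bi

module _ (H : Graph) (γ≡3 : γr2≡ H 3)
         (no-both : ∀ φ → IsMinR2DF H φ → ∀ h → φ h ≢ both) where

  ≤3⇒minimum : ∀ {φ} → IsR2DF H φ → weight H φ ≤ 3 → IsMinR2DF H φ
  ≤3⇒minimum rφ w≤3 = rφ , λ ψ rψ → ≤-trans w≤3 (proj₂ γ≡3 ψ rψ)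

  dominates-weight : ∀ c φ → Dominates H c φ →
    3 ≤ weightᶜ H c φ + weightᶜ H (other c) φ ⊎
    4 ≤ 2 * weightᶜ H c φ + weightᶜ H (other c) φ
  dominates-weight c φ dom with any? (λ h → only? c (φ h))
  ... | no no-only = inj₁ (subst (3 ≤_) (weight≡weightᶜ+weightᶜ H c φ) (proj₂ γ≡3 φ rφ))
    where
    rφ : IsR2DF H φ
    rφ = both-neighbour⇒r2df {H} λ h φh≡∅ →
      let h′ , hh′ , has = dom h φh≡∅
      in h′ , hh′ , Has∧≢only⇒both c has λ φh′≡only → no-only (h′ , φh′≡only)
  ... | yes (h₀ , φh₀≡only) = inj₂ (≤-trans 4≤ψ ψ≤)
    where
    ψ : V H → Label
    ψ = saturate c ∘ φ

    rψ : IsR2DF H ψ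
    rψ = both-neighbour⇒r2df {H} λ h ψh≡∅ →
      let h′ , hh′ , has = dom h (saturate≡∅⇒≡∅ c (φ h) ψh≡∅)
      in h′ , hh′ , Has⇒saturate≡both c has

    4≤ψ : 4 ≤ weight H ψ
    4≤ψ = ≰⇒> λ ψ≤3 → no-both ψ (≤3⇒minimum rψ ψ≤3) h₀
      (trans (cong (saturate c) φh₀≡only) (saturate-only c))

    ψ≤ : weight H ψ ≤ 2 * weightᶜ H c φ + weightᶜ H (other c) φ
    ψ≤ = begin
      weight H ψ
        ≡⟨ weight≡∑ H ψ ⟩
      ∑ (λ h → ∣ ψ h ∣ₗ)
        ≤⟨ ∑-mono-≤ (∣saturate∣≤ c ∘ φ) ⟩
      ∑ (λ h → 2 * occ c (φ h) + occ (other c) (φ h))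
        ≡⟨ ∑-distrib-+ (λ h → 2 * occ c (φ h)) (occ (other c) ∘ φ) ⟩
      ∑ (λ h → 2 * occ c (φ h)) + weightᶜ H (other c) φ
        ≡⟨ cong (_+ weightᶜ H (other c) φ) (*-distribˡ-∑ 2 (occ c ∘ φ)) ⟨
      2 * weightᶜ H c φ + weightᶜ H (other c) φ ∎
      where open ≤-Reasoning

-- Lower bound

costOf : ∀ {P S : Set} → Dec P → Dec S → ℕ
costOf p (yes _) = 2 * 𝟙 (does p)
costOf p (no _)  = 3

costOf-indicator : ∀ {P S : Set} (p : Dec P) (s : Dec S) →
  2 * 𝟙 (does (p ×-dec s)) + 3 * 𝟙 (does (¬? s)) ≡ costOf p s
costOf-indicator (true  because _) (yes _) = refl
costOf-indicator (false because _) (yes _) = refl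
costOf-indicator (true  because _) (no _)  = refl
costOf-indicator (false because _) (no _)  = refl

𝟙[1≤?]≤ : ∀ m → 𝟙 (does (1 ≤? m)) ≤ m
𝟙[1≤?]≤ zero    = z≤n
𝟙[1≤?]≤ (suc m) = s≤s z≤n

seen-seen-≤ : ∀ a b → 2 * 𝟙 (does (1 ≤? a)) + 2 * 𝟙 (does (1 ≤? b)) ≤ 2 * (a + b)
seen-seen-≤ a b =
  ≤-trans (+-mono-≤ (*-monoʳ-≤ 2 (𝟙[1≤?]≤ a)) (*-monoʳ-≤ 2 (𝟙[1≤?]≤ b)))
          (≤-reflexive (sym (*-distribˡ-+ 2 a b)))

unseen-seen-≤ : ∀ a b → 3 ≤ a + b ⊎ 4 ≤ 2 * a + b →
  3 + 2 * 𝟙 (does (1 ≤? b)) ≤ 2 * (a + b)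
unseen-seen-≤ a zero    (inj₁ 3≤a+0)  = ≤-trans 3≤a+0 (m≤m+n (a + 0) _)
unseen-seen-≤ a zero    (inj₂ 4≤2a+0) =
  ≤-trans (n≤1+n 3)
    (subst (4 ≤_) (trans (+-identityʳ (2 * a)) (cong (2 *_) (sym (+-identityʳ a)))) 4≤2a+0)
unseen-seen-≤ a (suc b) (inj₁ 3≤a+b)  = ≤-trans (n≤1+n 5) (*-monoʳ-≤ 2 3≤a+b)
unseen-seen-≤ a (suc b) (inj₂ 4≤2a+b) = begin
  4 + 1
    ≤⟨ +-mono-≤ 4≤2a+b (s≤s z≤n) ⟩
  2 * a + suc b + suc b
    ≡⟨ +-assoc (2 * a) (suc b) (suc b) ⟩
  2 * a + (suc b + suc b)
    ≡⟨ cong (λ x → 2 * a + (suc b + x)) (+-identityʳ (suc b)) ⟨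
  2 * a + 2 * suc b
    ≡⟨ *-distribˡ-+ 2 a (suc b) ⟨
  2 * (a + suc b) ∎
  where open ≤-Reasoning

module LexLowerBound (H : Graph) (γ≡3 : γr2≡ H 3)
                     (no-both : ∀ φ → IsMinR2DF H φ → ∀ h → φ h ≢ both)
                     (G : Graph) (f : V (G ∘ₗ H) → Label) (rf : IsR2DF (G ∘ₗ H) f) where

  fibre : V G → V H → Label
  fibre g h = f (combine g h)

  wᶜ : Colour → V G → ℕ
  wᶜ c g = weightᶜ H c (fibre g)

  Present : Colour → V G → Set
  Present c g = 1 ≤ wᶜ c g

  present? : ∀ c g → Dec (Present c g)
  present? c g = 1 ≤? wᶜ c g

  Sees : Colour → V G → Set
  Sees c g = ∃ λ g′ → Adj G g g′ × Present c g′

  sees? : ∀ c g → Dec (Sees c g)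
  sees? c g = any? λ g′ → (adj G g g′ Bool.≟ true) ×-dec present? c g′

  inA? : ∀ c g → Dec (Present c g × Sees c g)
  inA? c g = present? c g ×-dec sees? c g

  inB? : ∀ c g → Dec (¬ Sees c g)
  inB? c g = ¬? (sees? c g)

  A B : Colour → Subset (n G)
  A c = subsetOf (inA? c)
  B c = subsetOf (inB? c)

  cost : Colour → V G → ℕ
  cost c g = costOf (present? c g) (sees? c g)

  unseen⇒dominates : ∀ c g → ¬ Sees c g → Dominates H c (fibre g)
  unseen⇒dominates c g unseen h fgh≡∅
    with ∃-combine {n G} {n H} {λ u → Adj (G ∘ₗ H) (combine g h) u × Has c (f u)}
                   (r2df⇒dominates {G ∘ₗ H} rf c (combine g h) fgh≡∅)
  ... | g′ , h′ , adj′ , has with lex-adj⁻ G H adj′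
  ... | inj₁ gg′ =
    ⊥-elim (unseen (g′ , gg′ , ≤-trans (Has⇒1≤occ c has) (term≤∑ (occ c ∘ fibre g′) h′)))
  ... | inj₂ (refl , hh′) = h′ , hh′ , has

  dominating : ∀ c → IsDomCouple G (A c) (B c)
  dominating c = disjoint , dominated
    where
    disjoint : Empty (A c ∩ B c)
    disjoint (x , x∈A∩B) =
      let x∈A , x∈B = x∈p∩q⁻ (A c) (B c) x∈A∩B
      in ∈-subsetOf⁻ (inB? c) x∈B (proj₂ (∈-subsetOf⁻ (inA? c) x∈A))

    dominated : ∀ x → x ∉ B c → ∃ λ w → (w ∈ A c ⊎ w ∈ B c) × Adj G w x
    dominated x x∉B = g′ , member , trans (adj-sym G g′ x) xg′
      where
      seen = decidable-stable (sees? c x) (x∉B ∘ ∈-subsetOf⁺ (inB? c))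
      g′ = proj₁ seen
      xg′ = proj₁ (proj₂ seen)
      member : g′ ∈ A c ⊎ g′ ∈ B c
      member with sees? c g′
      ... | yes s = inj₁ (∈-subsetOf⁺ (inA? c) (proj₂ (proj₂ seen) , s))
      ... | no ¬s = inj₂ (∈-subsetOf⁺ (inB? c) ¬s)

  cost-pointwise : ∀ c g → 2 * 𝟙[ g ∈ A c ] + 3 * 𝟙[ g ∈ B c ] ≡ cost c g
  cost-pointwise c g = trans
    (cong₂ (λ x y → 2 * 𝟙 x + 3 * 𝟙 y)
           (does-∈-subsetOf (inA? c) g) (does-∈-subsetOf (inB? c) g))
    (costOf-indicator (present? c g) (sees? c g))

  couple-cost : ∀ c → coupleCost (A c) (B c) ≡ ∑ (cost c)
  couple-cost c = trans (card-combination≡∑ 2 3 (A c) (B c)) (sum-cong-≗ (cost-pointwise c))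

  fibre-weight-split : ∀ c g → 2 * (wᶜ c g + wᶜ (other c) g) ≤ 2 * weight H (fibre g)
  fibre-weight-split c g = ≤-reflexive (cong (2 *_) (sym (weight≡weightᶜ+weightᶜ H c (fibre g))))

  unseen-weight : ∀ c g → ¬ Sees c g →
    3 ≤ wᶜ c g + wᶜ (other c) g ⊎ 4 ≤ 2 * wᶜ c g + wᶜ (other c) g
  unseen-weight c g unseen =
    dominates-weight H γ≡3 no-both c (fibre g) (unseen⇒dominates c g unseen)

  cost-≤ : ∀ g (s₁ : Dec (Sees c₁ g)) (s₂ : Dec (Sees c₂ g)) →
    costOf (present? c₁ g) s₁ + costOf (present? c₂ g) s₂ ≤ 2 * weight H (fibre g)
  cost-≤ g (yes _) (yes _) =
    ≤-trans (seen-seen-≤ (wᶜ c₁ g) (wᶜ c₂ g)) (fibre-weight-split c₁ g)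
  cost-≤ g (no u₁) (no u₂) = *-monoʳ-≤ 2 (proj₂ γ≡3 (fibre g) (dominates⇒r2df {H} λ
    { c₁ → unseen⇒dominates c₁ g u₁
    ; c₂ → unseen⇒dominates c₂ g u₂ }))
  cost-≤ g (no u₁) (yes _) =
    ≤-trans (unseen-seen-≤ (wᶜ c₁ g) (wᶜ c₂ g) (unseen-weight c₁ g u₁)) (fibre-weight-split c₁ g)
  cost-≤ g (yes _) (no u₂) =
    ≤-trans (≤-reflexive (+-comm _ 3)) (≤-trans
      (unseen-seen-≤ (wᶜ c₂ g) (wᶜ c₁ g) (unseen-weight c₂ g u₂)) (fibre-weight-split c₂ g))

  couples-cost-≤ : coupleCost (A c₁) (B c₁) + coupleCost (A c₂) (B c₂) ≤ 2 * weight (G ∘ₗ H) f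
  couples-cost-≤ = begin
    coupleCost (A c₁) (B c₁) + coupleCost (A c₂) (B c₂)
      ≡⟨ cong₂ _+_ (couple-cost c₁) (couple-cost c₂) ⟩
    ∑ (cost c₁) + ∑ (cost c₂)
      ≡⟨ ∑-distrib-+ (cost c₁) (cost c₂) ⟨
    ∑ (λ g → cost c₁ g + cost c₂ g)
      ≤⟨ ∑-mono-≤ (λ g → cost-≤ g (sees? c₁ g) (sees? c₂ g)) ⟩
    ∑ (λ g → 2 * weight H (fibre g))
      ≡⟨ *-distribˡ-∑ 2 (weight H ∘ fibre) ⟨
    2 * ∑ (weight H ∘ fibre)
      ≡⟨ cong (2 *_) (weight-lex G H f) ⟨
    2 * weight (G ∘ₗ H) f ∎
    where open ≤-Reasoning

  lex-lower-bound : ∀ k → (∀ A B → IsDomCouple G A B → k ≤ coupleCost A B) →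
    k ≤ weight (G ∘ₗ H) f
  lex-lower-bound k k≤ = *-cancelˡ-≤ 2 (begin
    2 * k
      ≡⟨ cong (k +_) (+-identityʳ k) ⟩
    k + k
      ≤⟨ +-mono-≤ (k≤ _ _ (dominating c₁)) (k≤ _ _ (dominating c₂)) ⟩
    coupleCost (A c₁) (B c₁) + coupleCost (A c₂) (B c₂)
      ≤⟨ couples-cost-≤ ⟩
    2 * weight (G ∘ₗ H) f ∎)
    where open ≤-Reasoning

-- Upper bound

module LexUpperBound (G H : Graph) (ψ : V H → Label) (rψ : IsR2DF H ψ) (bi : Bichromatic H ψ)
                     (A B : Subset (n G)) (dc : IsDomCouple G A B) where

  a₁ : V H
  a₁ = proj₁ (bi c₁)

  spike : V H → Label
  spike h = if does (h ≟ a₁) then both else ∅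

  spike-a₁ : spike a₁ ≡ both
  spike-a₁ = cong (if_then both else ∅) (dec-true (a₁ ≟ a₁) refl)

  weight-spike : weight H spike ≡ 2
  weight-spike =
    trans (weight≡∑ H spike) (trans (∑-single a₁ (∣_∣ₗ ∘ spike) off) (cong ∣_∣ₗ spike-a₁))
    where
    off : ∀ h → h ≢ a₁ → ∣ spike h ∣ₗ ≡ 0
    off h h≢a₁ = cong (λ b → ∣ if b then both else ∅ ∣ₗ) (dec-false (h ≟ a₁) h≢a₁)

  layer : ∀ {P Q : Set} → Dec P → Dec Q → V H → Label
  layer (yes _) _       = ψ
  layer (no _)  (yes _) = spike
  layer (no _)  (no _)  = λ _ → ∅

  fibre : V G → V H → Label
  fibre g = layer (g ∈? B) (g ∈? A)

  f : V (G ∘ₗ H) → Label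
  f = fromFibres fibre

  fibre-B : ∀ {g} h → g ∈ B → fibre g h ≡ ψ h
  fibre-B {g} h g∈B rewrite proj₂ (dec-yes (g ∈? B) g∈B) = refl

  fibre-A : ∀ {g} h → g ∉ B → g ∈ A → fibre g h ≡ spike h
  fibre-A {g} h g∉B g∈A rewrite dec-no (g ∈? B) g∉B | proj₂ (dec-yes (g ∈? A) g∈A) = refl

  neighbour : ∀ {v g′ h′} c → Adj (G ∘ₗ H) v (combine g′ h′) → Has c (fibre g′ h′) →
    ∃ λ u → Adj (G ∘ₗ H) v u × Has c (f u)
  neighbour c vu has = _ , vu , subst (Has c) (sym (fromFibres-combine fibre _ _)) has

  fibre-dominates : ∀ g h → fibre g h ≡ ∅ → ∀ c →
    ∃ λ u → Adj (G ∘ₗ H) (combine g h) u × Has c (f u)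
  fibre-dominates g h fgh≡∅ c with g ∈? B
  ... | yes g∈B =
    let h′ , hh′ , has = r2df⇒dominates {H} rψ c h fgh≡∅
    in neighbour c (lex-adj-inner G H g hh′) (subst (Has c) (sym (fibre-B h′ g∈B)) has)
  ... | no g∉B with proj₂ dc g g∉B
  ... | w , w∈A⊎B , wg with w ∈? B | w∈A⊎B
  ...   | yes w∈B | _ =
    let a , has = bi c
    in neighbour c (lex-adj-outer G H h a (trans (adj-sym G g w) wg))
                   (subst (Has c) (sym (fibre-B a w∈B)) has)
  ...   | no w∉B | inj₁ w∈A =
    neighbour c (lex-adj-outer G H h a₁ (trans (adj-sym G g w) wg))
                (subst (Has c) (sym (trans (fibre-A a₁ w∉B w∈A) spike-a₁)) (Has-both c))
  ...   | no w∉B | inj₂ w∈B = ⊥-elim (w∉B w∈B)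

  r2df : IsR2DF (G ∘ₗ H) f
  r2df = dominates⇒r2df {G ∘ₗ H} λ c →
    ∀-combine {n G} {n H} {λ v → f v ≡ ∅ → ∃ λ u → Adj (G ∘ₗ H) v u × Has c (f u)}
      λ g h fv≡∅ → fibre-dominates g h (trans (sym (fromFibres-combine fibre g h)) fv≡∅) c

  weight-layer : ∀ {P Q : Set} (b : Dec P) (a : Dec Q) →
    weight H (layer b a) ≤ 2 * 𝟙 (does a) + weight H ψ * 𝟙 (does b)
  weight-layer (yes _) _       = ≤-trans (≤-reflexive (sym (*-identityʳ _))) (m≤n+m _ _)
  weight-layer (no _)  (yes _) = ≤-trans (≤-reflexive weight-spike) (m≤m+n 2 _)
  weight-layer (no _)  (no _)  =
    ≤-trans (≤-reflexive (trans (weight≡∑ H (λ _ → ∅)) (∑-zero {n H} λ _ → refl))) z≤n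

  weight-≤ : weight (G ∘ₗ H) f ≤ 2 * ∣ A ∣ + weight H ψ * ∣ B ∣
  weight-≤ = begin
    weight (G ∘ₗ H) f
      ≡⟨ weight-lex G H f ⟩
    ∑[ g < n G ] weight H (λ h → f (combine g h))
      ≡⟨ sum-cong-≗ (λ (g : V G) → weight-cong H (fromFibres-combine fibre g)) ⟩
    ∑[ g < n G ] weight H (fibre g)
      ≤⟨ ∑-mono-≤ (λ g → weight-layer (g ∈? B) (g ∈? A)) ⟩
    ∑ (λ g → 2 * 𝟙[ g ∈ A ] + weight H ψ * 𝟙[ g ∈ B ])
      ≡⟨ card-combination≡∑ 2 (weight H ψ) A B ⟨
    2 * ∣ A ∣ + weight H ψ * ∣ B ∣ ∎
    where open ≤-Reasoning

lex-upper-bound : ∀ H → γr2≡ H 3 → ∀ G A B → IsDomCouple G A B →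
  ∃ λ f → IsR2DF (G ∘ₗ H) f × weight (G ∘ₗ H) f ≤ coupleCost A B
lex-upper-bound H γ≡3 G A B dc with bichromatic-minimum H γ≡3
... | ψ , rψ , ψ≤3 , bi =
  f , r2df , ≤-trans weight-≤ (+-monoʳ-≤ (2 * ∣ A ∣) (*-monoˡ-≤ ∣ B ∣ ψ≤3))
  where open LexUpperBound G H ψ rψ bi A B dc

-- Minimum dominating couples

module _ {P : ℕ → Set} (P? : Decidable P) where

  least-below : ∀ b → (∃ λ k → P k × ∀ j → P j → k ≤ j) ⊎ (∀ j → j < b → ¬ P j)
  least-below zero = inj₂ λ _ ()
  least-below (suc b) with least-below b
  ... | inj₁ least = inj₁ least
  ... | inj₂ none with P? b
  ...   | yes pb = inj₁ (b , pb , λ j pj → ≮⇒≥ λ j<b → none j j<b pj)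
  ...   | no ¬pb = inj₂ λ j j<1+b pj → case m≤n⇒m<n∨m≡n (≤-pred j<1+b) of λ
    { (inj₁ j<b)  → none j j<b pj
    ; (inj₂ refl) → ¬pb pj }

  least-witness : ∀ {m} → P m → ∃ λ k → P k × ∀ j → P j → k ≤ j
  least-witness {m} pm with least-below (suc m)
  ... | inj₁ least = least
  ... | inj₂ none  = ⊥-elim (none m ≤-refl pm)

isDomCouple? : ∀ G A B → Dec (IsDomCouple G A B)
isDomCouple? G A B =
  ¬? (any? (_∈? A ∩ B)) ×-dec
  all? λ x → ¬? (x ∈? B) →-dec
    any? λ w → (w ∈? A ⊎-dec w ∈? B) ×-dec (adj G w x Bool.≟ true)

module _ (G : Graph) where

  CouplesOfCost : ℕ → Set
  CouplesOfCost k = ∃₂ λ A B → IsDomCouple G A B × coupleCost A B ≡ k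

  couplesOfCost? : Decidable CouplesOfCost
  couplesOfCost? k =
    anySubset? λ A → anySubset? λ B → isDomCouple? G A B ×-dec (coupleCost A B ≟ℕ k)

  ⊥⊤-dominating : IsDomCouple G ⊥ ⊤
  ⊥⊤-dominating =
    (λ (x , x∈⊥∩⊤) → ∉⊥ (proj₁ (x∈p∩q⁻ ⊥ ⊤ x∈⊥∩⊤))) , λ x x∉⊤ → ⊥-elim (x∉⊤ ∈⊤)

  minCouple-exists : ∃ (minCouple≡ G)
  minCouple-exists with least-witness couplesOfCost? (⊥ , ⊤ , ⊥⊤-dominating , refl)
  ... | k , couple , least = k , couple , λ A B dc → least _ (A , B , dc , refl)

theorem13 : (H : Graph) → Connected H → γr2≡ H 3 →
    (∀ φ → IsMinR2DF H φ → ∀ h → φ h ≢ both) →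
    (G : Graph) → ∃ λ (k : ℕ) → γr2≡ (G ∘ₗ H) k × minCouple≡ G k
theorem13 H _ γ≡3 no-both G with minCouple-exists G
... | k , minimum@((A , B , dc , cost≡k) , k≤cost) with lex-upper-bound H γ≡3 G A B dc
... | f , rf , f≤cost =
  k , ((f , rf , ≤-antisym (≤-trans f≤cost (≤-reflexive cost≡k)) (k≤weight f rf)) , k≤weight)
    , minimum
  where
  k≤weight : ∀ f → IsR2DF (G ∘ₗ H) f → k ≤ weight (G ∘ₗ H) f
  k≤weight f rf = LexLowerBound.lex-lower-bound H γ≡3 no-both G f rf k k≤cost
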